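{- Let $p$ be an odd prime and $m\le n$ positive integers. For $1\le i\le m$ let $t_i\in\mathbb{N}$ and $$f_i(x_1,\dots,x_n)=\sum_{j=1}^{t_i}a_j^{(i)}x_1^{\alpha_j^{(i1)}}\cdots x_n^{\alpha_j^{(in)}},$$ with $a_j^{(i)}\in\mathbb{Z}_p$ and $\alpha_j^{(i\ell)}=\overline{(\alpha_{jk}^{(i\ell)})}_k\in\mathcal{E}_p$, viewed as functions of $(x_1,\dots,x_n)\in(\mathbb{Z}_p^\times)^n$, and set $\mathbf{f}=(f_1,\dots,f_m)$. Let $\mathbf{y}=(y_1,\dots,y_m)\in\mathbb{Z}_p^m$ and let $\mathbf{x}_1=(x_{11},\dots,x_{n1})\in\mathbb{Z}^n$ with $p\nmid x_{\ell1}$ for $1\le\ell\le n$ be such that (i) $\mathbf{f}(\mathbf{x}_1)\equiv\mathbf{y}\pmod p$ (coordinatewise), and (ii) the $m\times n$ matrix $J_p\mathbf{f}(\mathbf{x}_1)\in(\mathbb{Z}/p\mathbb{Z})^{m\times n}$ with $(i,\ell)$ entry $$\sum_{j=1}^{t_i}a_j^{(i)}\,\alpha_{j2}^{(i\ell)}\,x_{\ell1}^{ -1}\,x_{11}^{\alpha_j^{(i1)}}\cdots x_{n1}^{\alpha_j^{(in)}}\pmod p$$ has rank $m$. Then there exists $\mathbf{x}=(x_1,\dots,x_n)\in(\mathbb{Z}_p^\times)^n$ with $x_\ell=\overline{(x_{\ell1},\dots)}$ (first coordinate $x_{\ell1}$) for $1\le\ell\le n$ such that $\mathbf{f}(\mathbf{x})=\mathbf{y}$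 in $\mathbb{Z}_p^m$.
   Context: $\mathbb{Z}_p$ is modeled as the set of sequences $(a_k)_{k\in\mathbb{N}}$ of integers with $a_{k+1}\equiv a_k\pmod{p^k}$, modulo $a_k\equiv b_k\pmod{p^k}$ for all $k$, coordinatewise operations; units: $p\nmid a_1$; congruence modulo $p$ refers to first coordinates. $\mathcal{E}_p$ is the set of sequences $(\alpha_k)_{k\in\mathbb{N}}$ of integers with $\alpha_{k+1}\equiv\alpha_k\pmod{\varphi(p^k)}$, modulo $\alpha_k\equiv\beta_k\pmod{\varphi(p^k)}$ for all $k$ ($\varphi$ = Euler's totient). For $a=\overline{(a_k)}\in\mathbb{Z}_p^\times$ and $\alpha=\overline{(\alpha_k)}\in\mathcal{E}_p$, $a^\alpha:=\overline{(a_k^{\alpha_k})}$; integers are embedded as constant sequences; $x^{ -1}$ denotes the inverse modulo $p$. -}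

module Defs where

open import Data.Nat as ℕ using (ℕ; zero; suc)
open import Data.Nat.Coprimality using (coprime?)
open import Data.Integer as ℤ using (ℤ; +_; _-_)
open import Data.Integer.Divisibility using (_∣_)
open import Data.Fin using (Fin; zero; suc)
open import Data.List using (List; length; filter; map; upTo)
open import Relation.Nullary using (¬_)

_≡_[mod_] : ℤ → ℤ → ℕ → Set
a ≡ b [mod m ] = (+ m) ∣ (a - b)

φ : ℕ → ℕ
φ n = length (filter (λ i → coprime? i n) (map suc (upTo n)))

-- p-adic integers: sequences with index k here standing for the paper's
-- index k+1 (so `seq 0` is the paper's first coordinate a₁).
record ℤₚ (p : ℕ) : Set where
  field
    seq    : ℕ → ℤ
    compat : ∀ k → seq (suc k) ≡ seq k [mod p ℕ.^ suc k ]
open ℤₚ public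

_≈ₚ_ : ∀ {p} → ℤₚ p → ℤₚ p → Set
_≈ₚ_ {p} a b = ∀ k → seq a k ≡ seq b k [mod p ℕ.^ suc k ]

IsUnit : ∀ {p} → ℤₚ p → Set
IsUnit {p} a = ¬ ((+ p) ∣ seq a 0)

-- exponent ring 𝓔_p (same index shift; nonnegative representatives)
record 𝓔ₚ (p : ℕ) : Set where
  field
    eseq    : ℕ → ℕ
    ecompat : ∀ k → (+ eseq (suc k)) ≡ (+ eseq k) [mod φ (p ℕ.^ suc k) ]
open 𝓔ₚ public

ΣF : ∀ n → (Fin n → ℤ) → ℤ
ΣF zero    f = + 0
ΣF (suc n) f = f zero ℤ.+ ΣF n (λ i → f (suc i))

ΠF : ∀ n → (Fin n → ℤ) → ℤ
ΠF zero    f = + 1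
ΠF (suc n) f = f zero ℤ.* ΠF n (λ i → f (suc i))

evalCoord : ∀ {p} (n t : ℕ) → (Fin t → ℤₚ p) → (Fin t → Fin n → 𝓔ₚ p)
          → (Fin n → ℤₚ p) → ℕ → ℤ
evalCoord n t a α x k =
  ΣF t (λ j → seq (a j) k ℤ.* ΠF n (λ ℓ → seq (x ℓ) k ℤ.^ eseq (α j ℓ) k))

-- inverse modulo a prime p (Fermat representative x^{p-2})
invModP : ℕ → ℤ → ℤ
invModP p x = x ℤ.^ (p ℕ.∸ 2)

jacEntry : ∀ {p} (n t : ℕ) → (Fin t → ℤₚ p) → (Fin t → Fin n → 𝓔ₚ p)
         → (Fin n → ℤ) → Fin n → ℤ
jacEntry {p} n t a α x₁ ℓ =
  ΣF t (λ j → seq (a j) 0 ℤ.* (+ eseq (α j ℓ) 1) ℤ.* invModP p (x₁ ℓ)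
              ℤ.* ΠF n (λ ℓ' → x₁ ℓ' ℤ.^ eseq (α j ℓ') 0))

-- an m×n integer matrix M has rank m over ℤ/pℤ, i.e. its m rows are
-- linearly independent over ℤ/pℤ
HasRankMModP : (p m n : ℕ) → (Fin m → Fin n → ℤ) → Set
HasRankMModP p m n M =
  (c : Fin m → ℤ) → (∀ ℓ → ΣF m (λ i → c i ℤ.* M i ℓ) ≡ + 0 [mod p ])
  → ∀ i → c i ≡ + 0 [mod p ]

constℤₚ : ∀ {p} → ℤ → ℤₚ p
constℤₚ {p} z = record { seq = λ _ → z ; compat = λ k → subst (λ w → (+ (p ℕ.^ suc k)) ∣ w) (sym (i≡j⇒i-j≡0 {z} refl)) (ND._∣0 (p ℕ.^ suc k)) }
  where
    import Data.Nat.Divisibility as ND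
    open import Data.Integer.Properties using (i≡j⇒i-j≡0)
    open import Relation.Binary.PropositionalEquality using (subst; sym; refl)

{-# OPTIONS --safe #-}
module Submission where

-- Hensel lifting, one power of p at a time.  Write F_k for f with coefficients and exponents
-- replaced by their k-th coordinates, and suppose X ≡ x₁ (mod p) satisfies F_k(X) ≡ y
-- (mod p^(k+1)).  Since X is a unit and φ(p^(k+1)) = (p-1)p^k, Euler's theorem lets the exponents
-- move to level k+1, so F_{k+1}(X) = y + p^(k+1) r.  To first order,
-- F_{k+1}(X + p^(k+1) z) ≡ F_{k+1}(X) + p^(k+1) J z (mod p^(k+2)), and J ≡ J_p f(x₁) (mod p)
-- because exponents in 𝓔_p agree modulo p-1 (Fermat) and, from the second coordinate on,
-- modulo p.  Full rank lets Gaussian elimination solve J z ≡ -r (mod p); the corrected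
-- points are the coordinates of the p-adic solution.

open import Defs
open import Data.Nat using (ℕ; _≤_)
open import Data.Nat.Primality using (Prime)
open import Data.Nat.Divisibility as ND using ()
open import Data.Integer using (ℤ; +_)
open import Data.Integer.Divisibility using (_∣_)
open import Data.Fin using (Fin)
open import Data.Product using (Σ; _×_)
open import Relation.Nullary using (¬_)
open import Relation.Binary.PropositionalEquality using (_≡_)

open import Data.Fin as Fin using (zero; suc)
import Data.Fin.Properties as Fin
open import Data.Integer as ℤ using (_+_; _*_; -_; _-_; ∣_∣; _^_; _⊖_)
open import Data.Integer.DivMod using (_%ℕ_; _/ℕ_; a≡a%ℕn+[a/ℕn]*n)
import Data.Integer.Divisibility.Signed as Signed
open import Data.Integer.Properties
open import Data.Integer.Tactic.RingSolver using (solve-∀)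
open import Algebra.Bundles using (Semiring)
open import Algebra.Definitions.RawMonoid ℤ.+-0-rawMonoid using () renaming (_×_ to _times_)
open import Algebra.Definitions.RawSemiring (Semiring.rawSemiring +-*-semiring)
  using () renaming (_^_ to _^ᴿ_)
open import Algebra.Properties.CommutativeSemiring.Binomial +-*-commutativeSemiring
  using (theorem; binomialTerm)
open import Algebra.Properties.Semiring.Sum +-*-semiring
  using (sum; sum-cong-≗; sum-replicate-zero; ∑-distrib-+; ∑-comm; *-distribˡ-sum; *-distribʳ-sum)
open import Data.List using (length; filter; map; upTo; _++_; [_])
import Data.List.Properties as List
open import Data.Nat as ℕ using (zero; suc; _∸_)
open import Data.Nat.Combinatorics using (_C_; nC1≡n; nCn≡1; nCk+nC[k+1]≡[n+1]C[k+1])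
open import Data.Nat.Coprimality using (Coprime; coprime?; coprime-divisor)
open import Data.Nat.Primality using (euclidsLemma; prime⇒irreducible; prime⇒nonZero; ¬prime[1])
import Data.Nat.Properties as ℕ
open import Data.Product using (_,_; proj₁; proj₂; ∃)
open import Data.Sum using (inj₁; inj₂; [_,_]′)
open import Data.Vec.Functional using (updateAt)
open import Function using (_∘_)
open import Level using (0ℓ)
open import Relation.Binary.Bundles using (Setoid)
open import Relation.Binary.PropositionalEquality
  using (refl; sym; trans; cong; cong₂; subst; module ≡-Reasoning)
import Relation.Binary.Reasoning.Setoid as SetoidReasoning
open import Relation.Nullary using (yes; no; contradiction)

-- Congruences

-- Unlike _≡_[mod_], whose unfolding ∣ a - b ∣ hides a and b, this record determines them,
-- so they can be left implicit.
infix 4 _≈_[mod_]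
record _≈_[mod_] (a b : ℤ) (N : ℕ) : Set where
  constructor congruence
  field
    quotient : ℤ
    equation : a ≡ b + quotient * + N
open _≈_[mod_] public

module _ {N : ℕ} where

  ≈-mod⇒≡-mod : ∀ {a b} → a ≈ b [mod N ] → a ≡ b [mod N ]
  ≈-mod⇒≡-mod {b = b} (congruence q refl) = Signed.∣⇒∣ᵤ (Signed.divides q (difference b q (+ N)))
    where difference : ∀ b q n → b + q * n - b ≡ q * n
          difference = solve-∀

  ≡-mod⇒≈-mod : ∀ {a b} → a ≡ b [mod N ] → a ≈ b [mod N ]
  ≡-mod⇒≈-mod {a} {b} a≡b with Signed.∣ᵤ⇒∣ a≡b
  ... | Signed.divides q a-b≡q*N = congruence q (trans (restore a b) (cong (λ x → b + x) a-b≡q*N))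
    where restore : ∀ a b → a ≡ b + (a - b)
          restore = solve-∀

  ≡⇒mod : ∀ {a b} → a ≡ b → a ≈ b [mod N ]
  ≡⇒mod {a} refl = congruence (+ 0) (no-quotient a (+ N))
    where no-quotient : ∀ a n → a ≡ a + + 0 * n
          no-quotient = solve-∀

  mod-refl : ∀ {a} → a ≈ a [mod N ]
  mod-refl = ≡⇒mod refl

  mod-sym : ∀ {a b} → a ≈ b [mod N ] → b ≈ a [mod N ]
  mod-sym {b = b} (congruence q refl) = congruence (- q) (identity b q (+ N))
    where identity : ∀ b q n → b ≡ b + q * n + - q * n
          identity = solve-∀

  mod-trans : ∀ {a b c} → a ≈ b [mod N ] → b ≈ c [mod N ] → a ≈ c [mod N ]
  mod-trans {c = c} (congruence q refl) (congruence r refl) = congruence (r + q) (identity c q r (+ N))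
    where identity : ∀ c q r n → c + r * n + q * n ≡ c + (r + q) * n
          identity = solve-∀

  mod-+ : ∀ {a b c d} → a ≈ b [mod N ] → c ≈ d [mod N ] → a + c ≈ b + d [mod N ]
  mod-+ {b = b} {d = d} (congruence q refl) (congruence r refl) = congruence (q + r) (identity b d q r (+ N))
    where identity : ∀ b d q r n → b + q * n + (d + r * n) ≡ b + d + (q + r) * n
          identity = solve-∀

  mod-* : ∀ {a b c d} → a ≈ b [mod N ] → c ≈ d [mod N ] → a * c ≈ b * d [mod N ]
  mod-* {b = b} {d = d} (congruence q refl) (congruence r refl) =
    congruence (q * d + b * r + q * r * + N) (identity b d q r (+ N))
    where identity : ∀ b d q r n → (b + q * n) * (d + r * n) ≡ b * d + (q * d + b * r + q * r * n) * n
          identity = solve-∀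

  mod-^ : ∀ {a b} e → a ≈ b [mod N ] → a ^ e ≈ b ^ e [mod N ]
  mod-^ zero    a≡b = mod-refl
  mod-^ (suc e) a≡b = mod-* a≡b (mod-^ e a≡b)

  multiple≈0 : ∀ q → q * + N ≈ + 0 [mod N ]
  multiple≈0 q = congruence q (sym (+-identityˡ (q * + N)))

  ≈0⇒∣ : ∀ {a} → a ≈ + 0 [mod N ] → N ND.∣ ∣ a ∣
  ≈0⇒∣ {a} a≡0 = subst (λ x → N ND.∣ ∣ x ∣) (+-identityʳ a) (≈-mod⇒≡-mod a≡0)

  ∣⇒≈0 : ∀ {a} → N ND.∣ ∣ a ∣ → a ≈ + 0 [mod N ]
  ∣⇒≈0 {a} N∣a = ≡-mod⇒≈-mod (subst (λ x → N ND.∣ ∣ x ∣) (sym (+-identityʳ a)) N∣a)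

  mod-+-≈0 : ∀ {a b} → b ≈ + 0 [mod N ] → a + b ≈ a [mod N ]
  mod-+-≈0 {a} b≡0 = mod-trans (mod-+ (mod-refl {a}) b≡0) (≡⇒mod (+-identityʳ a))

  mod-*-≈0 : ∀ {a} b → a ≈ + 0 [mod N ] → a * b ≈ + 0 [mod N ]
  mod-*-≈0 b a≡0 = mod-trans (mod-* a≡0 (mod-refl {b})) (≡⇒mod (*-zeroˡ b))

mod-∣ : ∀ {M N a b} → M ND.∣ N → a ≈ b [mod N ] → a ≈ b [mod M ]
mod-∣ {M} {b = b} (ND.divides k refl) (congruence q refl) =
  congruence (q * + k) (cong (λ x → b + x) (trans (cong (q *_) (pos-* k M)) (sym (*-assoc q (+ k) (+ M)))))

mod-scale : ∀ {N a b} P → a ≈ b [mod N ] → + P * a ≈ + P * b [mod P ℕ.* N ]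
mod-scale {N} {b = b} P (congruence q refl) =
  congruence q (trans (identity (+ P) b q (+ N)) (cong (λ x → + P * b + q * x) (sym (pos-* P N))))
  where identity : ∀ c b q n → c * (b + q * n) ≡ c * b + q * (c * n)
        identity = solve-∀

mod-setoid : ℕ → Setoid 0ℓ 0ℓ
mod-setoid N = record
  { Carrier = ℤ
  ; _≈_ = _≈_[mod N ]
  ; isEquivalence = record { refl = mod-refl ; sym = mod-sym ; trans = mod-trans }
  }

module mod-Reasoning (N : ℕ) = SetoidReasoning (mod-setoid N)

-- Finite sums and products

ΣF≡sum : ∀ n (f : Fin n → ℤ) → ΣF n f ≡ sum f
ΣF≡sum zero    f = refl
ΣF≡sum (suc n) f = cong (λ s → f zero + s) (ΣF≡sum n (f ∘ suc))

ΣF-cong : ∀ n {f g : Fin n → ℤ} → (∀ i → f i ≡ g i) → ΣF n f ≡ ΣF n g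
ΣF-cong n {f} {g} f≗g = trans (ΣF≡sum n f) (trans (sum-cong-≗ f≗g) (sym (ΣF≡sum n g)))

ΣF-zero : ∀ n → ΣF n (λ _ → + 0) ≡ + 0
ΣF-zero n = trans (ΣF≡sum n _) (sum-replicate-zero n)

ΣF-distrib-+ : ∀ n (f g : Fin n → ℤ) → ΣF n (λ i → f i + g i) ≡ ΣF n f + ΣF n g
ΣF-distrib-+ n f g
  rewrite ΣF≡sum n (λ i → f i + g i) | ΣF≡sum n f | ΣF≡sum n g = ∑-distrib-+ f g

*-distribˡ-ΣF : ∀ n c (f : Fin n → ℤ) → c * ΣF n f ≡ ΣF n (λ i → c * f i)
*-distribˡ-ΣF n c f rewrite ΣF≡sum n f | ΣF≡sum n (λ i → c * f i) = *-distribˡ-sum c f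

*-distribʳ-ΣF : ∀ n c (f : Fin n → ℤ) → ΣF n f * c ≡ ΣF n (λ i → f i * c)
*-distribʳ-ΣF n c f rewrite ΣF≡sum n f | ΣF≡sum n (λ i → f i * c) = *-distribʳ-sum c f

ΣF-comm : ∀ m n (f : Fin m → Fin n → ℤ) →
          ΣF m (λ i → ΣF n (f i)) ≡ ΣF n (λ j → ΣF m (λ i → f i j))
ΣF-comm m n f = begin
  ΣF m (λ i → ΣF n (f i))         ≡⟨ ΣF-cong m (λ i → ΣF≡sum n (f i)) ⟩
  ΣF m (λ i → sum (f i))          ≡⟨ ΣF≡sum m _ ⟩
  sum (λ i → sum (f i))           ≡⟨ ∑-comm f ⟩
  sum (λ j → sum (λ i → f i j))   ≡⟨ ΣF≡sum n _ ⟨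
  ΣF n (λ j → sum (λ i → f i j))  ≡⟨ ΣF-cong n (λ j → ΣF≡sum m (λ i → f i j)) ⟨
  ΣF n (λ j → ΣF m (λ i → f i j)) ∎
  where open ≡-Reasoning

ΣF-linear : ∀ n (f g : Fin n → ℤ) c → ΣF n (λ i → f i + c * g i) ≡ ΣF n f + c * ΣF n g
ΣF-linear n f g c =
  trans (ΣF-distrib-+ n f (λ i → c * g i)) (cong (λ s → ΣF n f + s) (sym (*-distribˡ-ΣF n c g)))

module _ {N : ℕ} where

  ΣF-cong-mod : ∀ n {f g : Fin n → ℤ} → (∀ i → f i ≈ g i [mod N ]) → ΣF n f ≈ ΣF n g [mod N ]
  ΣF-cong-mod zero    f≈g = mod-refl
  ΣF-cong-mod (suc n) f≈g = mod-+ (f≈g zero) (ΣF-cong-mod n (f≈g ∘ suc))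

  ΠF-cong-mod : ∀ n {f g : Fin n → ℤ} → (∀ i → f i ≈ g i [mod N ]) → ΠF n f ≈ ΠF n g [mod N ]
  ΠF-cong-mod zero    f≈g = mod-refl
  ΠF-cong-mod (suc n) f≈g = mod-* (f≈g zero) (ΠF-cong-mod n (f≈g ∘ suc))

-- Fermat's little theorem

C-absorption : ∀ n k → suc k ℕ.* (suc n C suc k) ≡ suc n ℕ.* (n C k)
C-absorption zero    zero    = refl
C-absorption zero    (suc k) = ℕ.*-zeroʳ (suc (suc k))
C-absorption (suc n) zero    =
  trans (ℕ.*-identityˡ _) (trans (nC1≡n (suc (suc n))) (sym (ℕ.*-identityʳ _)))
C-absorption (suc n) (suc k) = begin
  suc (suc k) ℕ.* (suc (suc n) C suc (suc k))
    ≡⟨ cong (suc (suc k) ℕ.*_) (nCk+nC[k+1]≡[n+1]C[k+1] (suc n) (suc k)) ⟨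
  suc (suc k) ℕ.* (suc n C suc k ℕ.+ suc n C suc (suc k))
    ≡⟨ ℕ.*-distribˡ-+ (suc (suc k)) (suc n C suc k) _ ⟩
  suc (suc k) ℕ.* (suc n C suc k) ℕ.+ suc (suc k) ℕ.* (suc n C suc (suc k))
    ≡⟨ cong₂ (λ u v → suc n C suc k ℕ.+ u ℕ.+ v) (C-absorption n k) (C-absorption n (suc k)) ⟩
  suc n C suc k ℕ.+ suc n ℕ.* (n C k) ℕ.+ suc n ℕ.* (n C suc k)
    ≡⟨ ℕ.+-assoc (suc n C suc k) _ _ ⟩
  suc n C suc k ℕ.+ (suc n ℕ.* (n C k) ℕ.+ suc n ℕ.* (n C suc k))
    ≡⟨ cong (suc n C suc k ℕ.+_) (ℕ.*-distribˡ-+ (suc n) (n C k) _) ⟨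
  suc n C suc k ℕ.+ suc n ℕ.* (n C k ℕ.+ n C suc k)
    ≡⟨ cong (λ c → suc n C suc k ℕ.+ suc n ℕ.* c) (nCk+nC[k+1]≡[n+1]C[k+1] n k) ⟩
  suc (suc n) ℕ.* (suc n C suc k) ∎
  where open ≡-Reasoning

p∣pCk : ∀ {p k} → Prime p → 0 ℕ.< k → k ℕ.< p → p ND.∣ p C k
p∣pCk {suc n} {suc j} p-prime _ k<p
  with euclidsLemma (suc j) _ p-prime
         (subst (suc n ND.∣_) (sym (C-absorption n j)) (ND.m∣m*n (n C j)))
... | inj₁ p∣k   = contradiction (ND.∣⇒≤ p∣k) (ℕ.<⇒≱ k<p)
... | inj₂ p∣pCk = p∣pCk

times≡* : ∀ n x → n times x ≡ + n * x
times≡* zero    x = sym (*-zeroˡ x)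
times≡* (suc n) x = begin
  x + n times x   ≡⟨ cong (_+_ x) (times≡* n x) ⟩
  x + + n * x     ≡⟨ cong (λ y → y + + n * x) (*-identityˡ x) ⟨
  + 1 * x + + n * x ≡⟨ *-distribʳ-+ x (+ 1) (+ n) ⟨
  + suc n * x     ∎
  where open ≡-Reasoning

^ᴿ≡^ : ∀ x n → x ^ᴿ n ≡ x ^ n
^ᴿ≡^ x zero    = refl
^ᴿ≡^ x (suc n) = cong (x *_) (^ᴿ≡^ x n)

∣⇒times≈0 : ∀ {N n} v → N ND.∣ n → n times v ≈ + 0 [mod N ]
∣⇒times≈0 {N} v (ND.divides c refl) =
  mod-trans (≡⇒mod (trans (times≡* (c ℕ.* N) v)
                          (trans (cong (_* v) (pos-* c N)) (rearrange (+ c) (+ N) v))))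
            (multiple≈0 (+ c * v))
  where rearrange : ∀ c n v → c * n * v ≡ c * v * n
        rearrange = solve-∀

sum-≈-ends : ∀ {N} q (f : Fin (suc (suc q)) → ℤ) →
             (∀ i → f (suc (Fin.inject₁ i)) ≈ + 0 [mod N ]) →
             sum f ≈ f zero + f (Fin.fromℕ (suc q)) [mod N ]
sum-≈-ends zero    f _      = mod-+ (mod-refl {a = f zero}) (≡⇒mod (+-identityʳ (f (suc zero))))
sum-≈-ends (suc q) f inner≈0 =
  mod-+ (mod-refl {a = f zero})
        (mod-trans (sum-≈-ends q (f ∘ suc) (inner≈0 ∘ suc))
                   (mod-trans (mod-+ (inner≈0 zero) mod-refl) (≡⇒mod (+-identityˡ _))))

binomialTerm-first : ∀ n x → binomialTerm x (+ 1) n zero ≡ + 1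
binomialTerm-first n x =
  trans (times≡* 1 _) (trans (*-identityˡ _) (trans (*-identityˡ _) (trans (^ᴿ≡^ (+ 1) n) (^-zeroˡ n))))

binomialTerm-last : ∀ n x → binomialTerm x (+ 1) n (Fin.fromℕ n) ≡ x ^ n
binomialTerm-last n x = begin
  binomialTerm x (+ 1) n (Fin.fromℕ n)
    ≡⟨ cong (λ j → (n C j) times (x ^ᴿ j * (+ 1) ^ᴿ (n ∸ j))) (Fin.toℕ-fromℕ n) ⟩
  (n C n) times (x ^ᴿ n * (+ 1) ^ᴿ (n ∸ n))
    ≡⟨ cong₂ (λ c e → c times (x ^ᴿ n * (+ 1) ^ᴿ e)) (nCn≡1 n) (ℕ.n∸n≡0 n) ⟩
  x ^ᴿ n * + 1 + + 0
    ≡⟨ trans (+-identityʳ _) (trans (*-identityʳ _) (^ᴿ≡^ x n)) ⟩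
  x ^ n ∎
  where open ≡-Reasoning

binomialTerm-inner : ∀ {q} → Prime (suc (suc q)) → ∀ x i →
                     binomialTerm x (+ 1) (suc (suc q)) (suc (Fin.inject₁ i)) ≈ + 0 [mod suc (suc q) ]
binomialTerm-inner {q} p-prime x i = ∣⇒times≈0 _ (p∣pCk p-prime (ℕ.s≤s ℕ.z≤n) (ℕ.s≤s k<q+1))
  where k<q+1 : Fin.toℕ (Fin.inject₁ i) ℕ.< suc q
        k<q+1 = subst (ℕ._< suc q) (sym (Fin.toℕ-inject₁ i)) (Fin.toℕ<n i)

freshman's-dream : ∀ {p} → Prime p → ∀ x → (x + + 1) ^ p ≈ x ^ p + + 1 [mod p ]
freshman's-dream {p@(suc (suc q))} p-prime x = begin
  (x + + 1) ^ p                  ≡⟨ ^ᴿ≡^ (x + + 1) p ⟨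
  (x + + 1) ^ᴿ p                 ≡⟨ theorem p x (+ 1) ⟩
  sum (binomialTerm x (+ 1) p)   ≈⟨ sum-≈-ends (suc q) (binomialTerm x (+ 1) p) (binomialTerm-inner p-prime x) ⟩
  binomialTerm x (+ 1) p zero + binomialTerm x (+ 1) p (Fin.fromℕ p)
                                 ≡⟨ cong₂ _+_ (binomialTerm-first p x) (binomialTerm-last p x) ⟩
  + 1 + x ^ p                    ≡⟨ +-comm (+ 1) (x ^ p) ⟩
  x ^ p + + 1                    ∎
  where open mod-Reasoning p

fermat-ℕ : ∀ {p} → Prime p → ∀ y → (+ y) ^ p ≈ + y [mod p ]
fermat-ℕ {suc _} p-prime zero    = mod-refl
fermat-ℕ {p}     p-prime (suc y) = begin
  (+ suc y) ^ p      ≡⟨ cong (_^ p) suc≡+1 ⟩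
  (+ y + + 1) ^ p    ≈⟨ freshman's-dream p-prime (+ y) ⟩
  (+ y) ^ p + + 1    ≈⟨ mod-+ (fermat-ℕ p-prime y) mod-refl ⟩
  + y + + 1          ≡⟨ suc≡+1 ⟨
  + suc y            ∎
  where
    open mod-Reasoning p
    suc≡+1 : + suc y ≡ + y + + 1
    suc≡+1 = trans (pos-+ 1 y) (+-comm (+ 1) (+ y))

fermat : ∀ {p} → Prime p → ∀ x → x ^ p ≈ x [mod p ]
fermat {p@(suc _)} p-prime x = begin
  x ^ p              ≈⟨ mod-^ p x≈r ⟩
  (+ r) ^ p          ≈⟨ fermat-ℕ p-prime r ⟩
  + r                ≈⟨ mod-sym x≈r ⟩
  x                  ∎
  where
    open mod-Reasoning p
    r = x %ℕ p
    x≈r : x ≈ + r [mod p ]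
    x≈r = congruence (x /ℕ p) (a≡a%ℕn+[a/ℕn]*n x p)

fermat-unit : ∀ {p} → Prime p → ∀ x → ¬ (p ND.∣ ∣ x ∣) → x ^ (p ∸ 1) ≈ + 1 [mod p ]
fermat-unit {p@(suc q)} p-prime x p∤x =
  [ (λ p∣x → contradiction p∣x p∤x) , ≡-mod⇒≈-mod ]′
    (euclidsLemma ∣ x ∣ ∣ x ^ q - + 1 ∣ p-prime p∣x[xᵠ-1])
  where
    x[xᵠ-1]≈0 : x * (x ^ q - + 1) ≈ + 0 [mod p ]
    x[xᵠ-1]≈0 = begin
      x * (x ^ q - + 1)  ≡⟨ expand x (x ^ q) ⟩
      x ^ p - x          ≈⟨ mod-+ (fermat p-prime x) mod-refl ⟩
      x - x              ≡⟨ +-inverseʳ x ⟩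
      + 0                ∎
      where
        open mod-Reasoning p
        expand : ∀ x y → x * (y - + 1) ≡ x * y - x
        expand = solve-∀
    p∣x[xᵠ-1] : p ND.∣ ∣ x ∣ ℕ.* ∣ x ^ q - + 1 ∣
    p∣x[xᵠ-1] = subst (p ND.∣_) (abs-* x _) (≈0⇒∣ x[xᵠ-1]≈0)

*-invModP≈1 : ∀ {p} → Prime p → ∀ x → ¬ (p ND.∣ ∣ x ∣) → x * invModP p x ≈ + 1 [mod p ]
*-invModP≈1 {suc (suc _)} p-prime x p∤x = fermat-unit p-prime x p∤x

-- Euler's theorem for prime powers

coprimeCount : ℕ → ℕ → ℕ
coprimeCount N m = length (filter (λ i → coprime? i N) (map suc (upTo m)))

coprimeCount-suc : ∀ N m →
  coprimeCount N (suc m) ≡ coprimeCount N m ℕ.+ length (filter (λ i → coprime? i N) [ suc m ])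
coprimeCount-suc N m = begin
  length (filter P? (map suc (upTo (suc m))))
    ≡⟨ cong (length ∘ filter P? ∘ map suc) (List.upTo-∷ʳ m) ⟨
  length (filter P? (map suc (upTo m ++ [ m ])))
    ≡⟨ cong (length ∘ filter P?) (List.map-++ suc (upTo m) [ m ]) ⟩
  length (filter P? (map suc (upTo m) ++ [ suc m ]))
    ≡⟨ cong length (List.filter-++ P? (map suc (upTo m)) [ suc m ]) ⟩
  length (filter P? (map suc (upTo m)) ++ filter P? [ suc m ])
    ≡⟨ List.length-++ (filter P? (map suc (upTo m))) ⟩
  coprimeCount N m ℕ.+ length (filter P? [ suc m ]) ∎
  where
    open ≡-Reasoning
    P? = λ i → coprime? i N

module _ {p} (p-prime : Prime p) where

  coprime⇒∤ : ∀ {k} j → Coprime k (p ℕ.^ suc j) → ¬ (p ND.∣ k)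
  coprime⇒∤ j coprime p∣k = ¬prime[1] (subst Prime (coprime (p∣k , ND.m∣m*n (p ℕ.^ j))) p-prime)

  ∤⇒coprime : ∀ {k} → ¬ (p ND.∣ k) → ∀ j → Coprime k (p ℕ.^ j)
  ∤⇒coprime p∤k zero    (_ , d∣1) = ND.∣1⇒≡1 d∣1
  ∤⇒coprime p∤k (suc j) {d} (d∣k , d∣pp^j) = ∤⇒coprime p∤k j (d∣k , coprime-divisor d⊥p d∣pp^j)
    where
      d⊥p : Coprime d p
      d⊥p {e} (e∣d , e∣p) with prime⇒irreducible p-prime e∣p
      ... | inj₁ e≡1 = e≡1
      ... | inj₂ refl = contradiction (ND.∣-trans e∣d d∣k) p∤k

  module _ (j : ℕ) where

    private
      N = p ℕ.^ suc j
      count = coprimeCount N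

    coprimeCount-∤ : ∀ m → ¬ (p ND.∣ suc m) → count (suc m) ≡ suc (count m)
    coprimeCount-∤ m p∤m+1 = trans (coprimeCount-suc N m)
      (trans (cong (λ xs → count m ℕ.+ length xs)
                   (List.filter-accept (λ i → coprime? i N) (∤⇒coprime p∤m+1 (suc j))))
             (ℕ.+-comm (count m) 1))

    coprimeCount-∣ : ∀ m → p ND.∣ suc m → count (suc m) ≡ count m
    coprimeCount-∣ m p∣m+1 = trans (coprimeCount-suc N m)
      (trans (cong (λ xs → count m ℕ.+ length xs)
                   (List.filter-reject (λ i → coprime? i N) (λ coprime → coprime⇒∤ j coprime p∣m+1)))
             (ℕ.+-identityʳ (count m)))

    coprimeCount-block : ∀ M r → r ℕ.< p → count (r ℕ.+ M ℕ.* p) ≡ r ℕ.+ count (M ℕ.* p)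
    coprimeCount-block M zero    _   = refl
    coprimeCount-block M (suc r) 1+r<p = begin
      count (suc (r ℕ.+ M ℕ.* p))   ≡⟨ coprimeCount-∤ (r ℕ.+ M ℕ.* p) p∤ ⟩
      suc (count (r ℕ.+ M ℕ.* p))   ≡⟨ cong suc (coprimeCount-block M r (ℕ.<⇒≤ 1+r<p)) ⟩
      suc (r ℕ.+ count (M ℕ.* p))   ∎
      where
        open ≡-Reasoning
        p∤ : ¬ (p ND.∣ suc r ℕ.+ M ℕ.* p)
        p∤ p∣ = ℕ.<⇒≱ 1+r<p (ND.∣⇒≤ (ND.∣m+n∣m⇒∣n (subst (p ND.∣_) (ℕ.+-comm (suc r) (M ℕ.* p)) p∣)
                                                  (ND.n∣m*n M)))

    coprimeCount-multiple : ∀ M → count (M ℕ.* p) ≡ (p ∸ 1) ℕ.* M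
    coprimeCount-multiple zero    = sym (ℕ.*-zeroʳ (p ∸ 1))
    coprimeCount-multiple (suc M) = begin
      count (p ℕ.+ M ℕ.* p)           ≡⟨ cong (λ n → count (n ℕ.+ M ℕ.* p)) p≡1+q ⟩
      count (suc (q ℕ.+ M ℕ.* p))     ≡⟨ coprimeCount-∣ (q ℕ.+ M ℕ.* p) p∣ ⟩
      count (q ℕ.+ M ℕ.* p)           ≡⟨ coprimeCount-block M q q<p ⟩
      q ℕ.+ count (M ℕ.* p)           ≡⟨ cong (q ℕ.+_) (coprimeCount-multiple M) ⟩
      q ℕ.+ q ℕ.* M                   ≡⟨ ℕ.*-suc q M ⟨
      q ℕ.* suc M                     ∎
      where
        open ≡-Reasoning
        q = p ∸ 1
        p≡1+q : p ≡ suc q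
        p≡1+q = sym (ℕ.suc-pred p {{prime⇒nonZero p-prime}})
        q<p : q ℕ.< p
        q<p = subst (q ℕ.<_) (sym p≡1+q) (ℕ.n<1+n q)
        p∣ : p ND.∣ suc (q ℕ.+ M ℕ.* p)
        p∣ = subst (λ n → p ND.∣ n ℕ.+ M ℕ.* p) p≡1+q (ND.∣m∣n⇒∣m+n ND.∣-refl (ND.n∣m*n M))

  φ-prime-power : ∀ j → φ (p ℕ.^ suc j) ≡ (p ∸ 1) ℕ.* p ℕ.^ j
  φ-prime-power j =
    trans (cong (coprimeCount (p ℕ.^ suc j)) (ℕ.*-comm p (p ℕ.^ j))) (coprimeCount-multiple j (p ℕ.^ j))

geometric : ℕ → ℤ → ℤ
geometric zero    u = + 0
geometric (suc n) u = + 1 + u * geometric n u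

pow≡1+[u-1]*geometric : ∀ u n → u ^ n ≡ + 1 + (u - + 1) * geometric n u
pow≡1+[u-1]*geometric u zero    = sym (trans (cong (_+_ (+ 1)) (*-zeroʳ (u - + 1))) (+-identityʳ (+ 1)))
pow≡1+[u-1]*geometric u (suc n) = trans (cong (u *_) (pow≡1+[u-1]*geometric u n)) (step u (geometric n u))
  where step : ∀ u g → u * (+ 1 + (u - + 1) * g) ≡ + 1 + (u - + 1) * (+ 1 + u * g)
        step = solve-∀

geometric-≈ : ∀ {N u} n → u ≈ + 1 [mod N ] → geometric n u ≈ + n [mod N ]
geometric-≈ zero    u≈1 = mod-refl
geometric-≈ {N} {u} (suc n) u≈1 = begin
  + 1 + u * geometric n u    ≈⟨ mod-+ (mod-refl {a = + 1}) (mod-* u≈1 (geometric-≈ n u≈1)) ⟩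
  + 1 + + 1 * + n            ≡⟨ cong (_+_ (+ 1)) (*-identityˡ (+ n)) ⟩
  + 1 + + n                  ∎
  where open mod-Reasoning N

self≈0 : ∀ N → + N ≈ + 0 [mod N ]
self≈0 N = congruence (+ 1) (sym (trans (+-identityˡ _) (*-identityˡ (+ N))))

-- From u ^ p - 1 = (u - 1)(1 + u + ⋯ + u ^ (p - 1)), where the second factor is ≡ p ≡ 0 (mod p).
pow-p-≈1 : ∀ {N} p → p ND.∣ N → ∀ {u} → u ≈ + 1 [mod N ] → u ^ p ≈ + 1 [mod p ℕ.* N ]
pow-p-≈1 {N} p p∣N {u} u≈1@(congruence q refl)
  with mod-trans (geometric-≈ p (mod-∣ p∣N u≈1)) (self≈0 p)
... | congruence r G≡rp = congruence (q * r) (begin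
  u ^ p                                          ≡⟨ pow≡1+[u-1]*geometric u p ⟩
  + 1 + (u - + 1) * geometric p u                 ≡⟨ cong (λ g → + 1 + (u - + 1) * g) G≡rp ⟩
  + 1 + (+ 1 + q * + N - + 1) * (+ 0 + r * + p)   ≡⟨ regroup q r (+ N) (+ p) ⟩
  + 1 + q * r * (+ p * + N)                       ≡⟨ cong (λ n → + 1 + q * r * n) (pos-* p N) ⟨
  + 1 + q * r * + (p ℕ.* N)                       ∎)
  where
    open ≡-Reasoning
    regroup : ∀ q r n p → + 1 + (+ 1 + q * n - + 1) * (+ 0 + r * p) ≡ + 1 + q * r * (p * n)
    regroup = solve-∀

pow-p^k-≈1 : ∀ p {u} → u ≈ + 1 [mod p ] → ∀ k → u ^ (p ℕ.^ k) ≈ + 1 [mod p ℕ.^ suc k ]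
pow-p^k-≈1 p {u} u≈1 zero    =
  mod-∣ (ND.∣-reflexive (ℕ.*-identityʳ p)) (mod-trans (≡⇒mod (*-identityʳ u)) u≈1)
pow-p^k-≈1 p {u} u≈1 (suc k) = subst (λ v → v ≈ + 1 [mod p ℕ.^ suc (suc k) ]) reassociate
  (pow-p-≈1 p (ND.m∣m*n (p ℕ.^ k)) (pow-p^k-≈1 p u≈1 k))
  where reassociate : (u ^ (p ℕ.^ k)) ^ p ≡ u ^ (p ℕ.^ suc k)
        reassociate = trans (^-*-assoc u (p ℕ.^ k) p) (cong (u ^_) (ℕ.*-comm (p ℕ.^ k) p))

euler-prime-power : ∀ {p} → Prime p → ∀ x → ¬ (p ND.∣ ∣ x ∣) → ∀ k →
                    x ^ φ (p ℕ.^ suc k) ≈ + 1 [mod p ℕ.^ suc k ]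
euler-prime-power {p} p-prime x p∤x k =
  subst (λ v → v ≈ + 1 [mod p ℕ.^ suc k ]) exponent (pow-p^k-≈1 p (fermat-unit p-prime x p∤x) k)
  where exponent : (x ^ (p ∸ 1)) ^ (p ℕ.^ k) ≡ x ^ φ (p ℕ.^ suc k)
        exponent = trans (^-*-assoc x (p ∸ 1) (p ℕ.^ k)) (cong (x ^_) (sym (φ-prime-power p-prime k)))

pow-cong-exponent-≤ : ∀ {N x d m n} → x ^ d ≈ + 1 [mod N ] → m ℕ.≤ n → d ND.∣ n ∸ m →
                      x ^ n ≈ x ^ m [mod N ]
pow-cong-exponent-≤ {N} {x} {d} {m} {n} xᵈ≈1 m≤n (ND.divides k n∸m≡k*d) = begin
  x ^ n                   ≡⟨ cong (x ^_) n≡m+k*d ⟩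
  x ^ (m ℕ.+ k ℕ.* d)     ≡⟨ ^-distribˡ-+-* x m (k ℕ.* d) ⟩
  x ^ m * x ^ (k ℕ.* d)   ≡⟨ cong (λ l → x ^ m * x ^ l) (ℕ.*-comm k d) ⟩
  x ^ m * x ^ (d ℕ.* k)   ≡⟨ cong (λ v → x ^ m * v) (^-*-assoc x d k) ⟨
  x ^ m * (x ^ d) ^ k     ≈⟨ mod-* (mod-refl {a = x ^ m}) (mod-^ k xᵈ≈1) ⟩
  x ^ m * (+ 1) ^ k       ≡⟨ trans (cong (λ v → x ^ m * v) (^-zeroˡ k)) (*-identityʳ (x ^ m)) ⟩
  x ^ m                   ∎
  where
    open mod-Reasoning N
    n≡m+k*d : n ≡ m ℕ.+ k ℕ.* d
    n≡m+k*d = trans (sym (ℕ.m+[n∸m]≡n m≤n)) (cong (m ℕ.+_) n∸m≡k*d)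

≈-mod⇒∣⊖∣ : ∀ {d e e′} → + e ≈ + e′ [mod d ] → d ND.∣ ∣ e ⊖ e′ ∣
≈-mod⇒∣⊖∣ {d} {e} {e′} e≈e′ = subst (λ v → d ND.∣ ∣ v ∣) ([+m]-[+n]≡m⊖n e e′) (≈-mod⇒≡-mod e≈e′)

pow-cong-exponent : ∀ {N x d e e′} → x ^ d ≈ + 1 [mod N ] → + e ≈ + e′ [mod d ] →
                    x ^ e ≈ x ^ e′ [mod N ]
pow-cong-exponent {d = d} {e} {e′} xᵈ≈1 e≈e′ with ℕ.≤-total e′ e
... | inj₁ e′≤e = pow-cong-exponent-≤ xᵈ≈1 e′≤e
                    (subst (d ND.∣_) (trans (∣m⊖n∣≡∣n⊖m∣ e e′) (∣⊖∣-≤ e′≤e)) (≈-mod⇒∣⊖∣ e≈e′))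
... | inj₂ e≤e′ = mod-sym (pow-cong-exponent-≤ xᵈ≈1 e≤e′
                             (subst (d ND.∣_) (∣⊖∣-≤ e≤e′) (≈-mod⇒∣⊖∣ e≈e′)))

-- Linear systems of full rank modulo a prime

infixl 7 _·_
_·_ : ∀ {n} → (Fin n → ℤ) → (Fin n → ℤ) → ℤ
_·_ {n} u v = ΣF n (λ ℓ → u ℓ * v ℓ)

·-updateAt : ∀ {n} (u z : Fin n → ℤ) ℓ₀ w → u · updateAt z ℓ₀ (_+ w) ≡ u · z + u ℓ₀ * w
·-updateAt {suc n} u z zero w = identity (u zero) (z zero) w (ΣF n (λ ℓ → u (suc ℓ) * z (suc ℓ)))
  where identity : ∀ a b w s → a * (b + w) + s ≡ a * b + s + a * w
        identity = solve-∀
·-updateAt {suc n} u z (suc ℓ₀) w =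
  trans (cong (_+_ (u zero * z zero)) (·-updateAt (u ∘ suc) (z ∘ suc) ℓ₀ w))
        (sym (+-assoc (u zero * z zero) _ _))

Solution : ∀ p {m n} → (Fin m → Fin n → ℤ) → (Fin m → ℤ) → Set
Solution p {n = n} M r = ∃ λ (z : Fin n → ℤ) → ∀ i → M i · z ≈ r i [mod p ]

module _ {p} (p-prime : Prime p) where

  private
    p∤1 : ¬ ((+ 1) ≡ + 0 [mod p ])
    p∤1 p∣1 = ¬prime[1] (subst Prime (ND.∣1⇒≡1 p∣1) p-prime)

  module Elimination {m n} (M : Fin (suc m) → Fin n → ℤ) (ℓ₀ : Fin n) where

    factor : Fin m → ℤ
    factor i = M (suc i) ℓ₀ * invModP p (M zero ℓ₀)

    reduced : Fin m → Fin n → ℤ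
    reduced i ℓ = M (suc i) ℓ - factor i * M zero ℓ

    reduced-rank : HasRankMModP p (suc m) n M → HasRankMModP p m n reduced
    reduced-rank rank c′ c′reduced≡0 i = rank c c·M≡0 (suc i)
      where
        c : Fin (suc m) → ℤ
        c zero    = - ΣF m (λ i → c′ i * factor i)
        c (suc i) = c′ i
        columns : ∀ ℓ → ΣF m (λ i → c′ i * reduced i ℓ) ≡ ΣF (suc m) (λ i → c i * M i ℓ)
        columns ℓ = begin
          ΣF m (λ i → c′ i * reduced i ℓ)
            ≡⟨ ΣF-cong m (λ i → expand (c′ i) (M (suc i) ℓ) (factor i) (M zero ℓ)) ⟩
          ΣF m (λ i → c′ i * M (suc i) ℓ + - M zero ℓ * (c′ i * factor i))
            ≡⟨ ΣF-linear m _ _ (- M zero ℓ) ⟩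
          ΣF m (λ i → c′ i * M (suc i) ℓ) + - M zero ℓ * ΣF m (λ i → c′ i * factor i)
            ≡⟨ swap (ΣF m (λ i → c′ i * M (suc i) ℓ)) (M zero ℓ) (ΣF m (λ i → c′ i * factor i)) ⟩
          c zero * M zero ℓ + ΣF m (λ i → c′ i * M (suc i) ℓ) ∎
          where
            open ≡-Reasoning
            expand : ∀ c a k b → c * (a - k * b) ≡ c * a + - b * (c * k)
            expand = solve-∀
            swap : ∀ s b t → s + - b * t ≡ - t * b + s
            swap = solve-∀
        c·M≡0 : ∀ ℓ → ΣF (suc m) (λ i → c i * M i ℓ) ≡ + 0 [mod p ]
        c·M≡0 ℓ = subst (_≡ + 0 [mod p ]) (columns ℓ) (c′reduced≡0 ℓ)

    reducedRhs : (Fin (suc m) → ℤ) → Fin m → ℤ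
    reducedRhs r i = r (suc i) - factor i * r zero

    reduced-· : ∀ i z → reduced i · z ≡ M (suc i) · z + - factor i * (M zero · z)
    reduced-· i z = trans (ΣF-cong n (λ ℓ → expand (M (suc i) ℓ) (factor i) (M zero ℓ) (z ℓ)))
                          (ΣF-linear n _ _ (- factor i))
      where expand : ∀ a k b z → (a - k * b) * z ≡ a * z + - k * (b * z)
            expand = solve-∀

    extend : (Fin (suc m) → ℤ) → (Fin n → ℤ) → Fin n → ℤ
    extend r z′ = updateAt z′ ℓ₀ (_+ invModP p (M zero ℓ₀) * (r zero - M zero · z′))

    extend-solves : ¬ (p ND.∣ ∣ M zero ℓ₀ ∣) → ∀ r z′ →
                    (∀ i → reduced i · z′ ≈ reducedRhs r i [mod p ]) →
                    ∀ i → M i · extend r z′ ≈ r i [mod p ]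
    extend-solves pivot-unit r z′ _ zero = begin
      M zero · extend r z′
        ≡⟨ ·-updateAt (M zero) z′ ℓ₀ _ ⟩
      M zero · z′ + M zero ℓ₀ * (u * (r zero - M zero · z′))
        ≡⟨ cong (_+_ (M zero · z′)) (sym (*-assoc (M zero ℓ₀) u _)) ⟩
      M zero · z′ + M zero ℓ₀ * u * (r zero - M zero · z′)
        ≈⟨ mod-+ (mod-refl {a = M zero · z′}) (mod-* pivot*u≈1 mod-refl) ⟩
      M zero · z′ + + 1 * (r zero - M zero · z′)
        ≡⟨ cancel (M zero · z′) (r zero) ⟩
      r zero ∎
      where
        open mod-Reasoning p
        u = invModP p (M zero ℓ₀)
        pivot*u≈1 : M zero ℓ₀ * u ≈ + 1 [mod p ]
        pivot*u≈1 = *-invModP≈1 p-prime (M zero ℓ₀) pivot-unit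
        cancel : ∀ s r → s + + 1 * (r - s) ≡ r
        cancel = solve-∀
    extend-solves pivot-unit r z′ solves′ (suc i) = begin
      M (suc i) · extend r z′
        ≡⟨ ·-updateAt (M (suc i)) z′ ℓ₀ _ ⟩
      M (suc i) · z′ + M (suc i) ℓ₀ * (u * (r zero - M zero · z′))
        ≡⟨ regroup (M (suc i) · z′) (M (suc i) ℓ₀) u (r zero) (M zero · z′) ⟩
      M (suc i) · z′ + - factor i * (M zero · z′) + factor i * r zero
        ≡⟨ cong (_+ factor i * r zero) (reduced-· i z′) ⟨
      reduced i · z′ + factor i * r zero
        ≈⟨ mod-+ (solves′ i) (mod-refl {a = factor i * r zero}) ⟩
      r (suc i) - factor i * r zero + factor i * r zero
        ≡⟨ cancel (r (suc i)) (factor i * r zero) ⟩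
      r (suc i) ∎
      where
        open mod-Reasoning p
        u = invModP p (M zero ℓ₀)
        regroup : ∀ s a u r s₀ → s + a * (u * (r - s₀)) ≡ s + - (a * u) * s₀ + a * u * r
        regroup = solve-∀
        cancel : ∀ r f → r - f + f ≡ r
        cancel = solve-∀

    extend-solution : ¬ (p ND.∣ ∣ M zero ℓ₀ ∣) → ∀ r → Solution p reduced (reducedRhs r) → Solution p M r
    extend-solution pivot-unit r (z′ , solves′) = extend r z′ , extend-solves pivot-unit r z′ solves′

  solve-fullRank : ∀ m {n} (M : Fin m → Fin n → ℤ) → HasRankMModP p m n M → ∀ r → Solution p M r
  solve-fullRank zero    M rank r = (λ _ → + 0) , λ ()
  solve-fullRank (suc m) {n} M rank r with Fin.all? (λ ℓ → p ND.∣? ∣ M zero ℓ ∣)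
  ... | yes p∣row₀ = contradiction (rank e₀ e₀·M≡0 zero) p∤1
    where
      e₀ : Fin (suc m) → ℤ
      e₀ zero    = + 1
      e₀ (suc _) = + 0
      e₀·M≡M₀ : ∀ ℓ → ΣF (suc m) (λ i → e₀ i * M i ℓ) ≡ M zero ℓ
      e₀·M≡M₀ ℓ = trans (cong₂ _+_ (*-identityˡ (M zero ℓ))
                                   (trans (ΣF-cong m (λ i → *-zeroˡ (M (suc i) ℓ))) (ΣF-zero m)))
                        (+-identityʳ (M zero ℓ))
      e₀·M≡0 : ∀ ℓ → ΣF (suc m) (λ i → e₀ i * M i ℓ) ≡ + 0 [mod p ]
      e₀·M≡0 ℓ = ≈-mod⇒≡-mod (mod-trans (≡⇒mod (e₀·M≡M₀ ℓ)) (∣⇒≈0 (p∣row₀ ℓ)))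
  ... | no ¬p∣row₀ with Fin.¬∀⟶∃¬ n _ (λ ℓ → p ND.∣? ∣ M zero ℓ ∣) ¬p∣row₀
  ...   | ℓ₀ , pivot-unit =
    extend-solution pivot-unit r (solve-fullRank m reduced (reduced-rank rank) (reducedRhs r))
    where open Elimination M ℓ₀

-- First-order expansions

eval : ∀ n t → (Fin t → ℤ) → (Fin t → Fin n → ℕ) → (Fin n → ℤ) → ℤ
eval n t A E X = ΣF t (λ j → A j * ΠF n (λ ℓ → X ℓ ^ E j ℓ))

-- ∂(eval n t A E)/∂Xℓ, with Xℓ⁻¹ represented by invModP p (X ℓ) as in jacEntry
jacobian : ∀ p n t → (Fin t → ℤ) → (Fin t → Fin n → ℕ) → (Fin n → ℤ) → Fin n → ℤ
jacobian p n t A E X ℓ = ΣF t (λ j → A j * + E j ℓ * invModP p (X ℓ) * ΠF n (λ ℓ′ → X ℓ′ ^ E j ℓ′))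

module FirstOrder (p P : ℕ) (p∣P : p ND.∣ P) where

  -- Modulo pP the square of P vanishes (as p ∣ P), so v ≈ V +P· s behaves like a first-order
  -- Taylor expansion whose slope s only matters modulo p.
  infix 4 _≈_+P·_
  record _≈_+P·_ (v V s : ℤ) : Set where
    constructor expansion
    field congruent : v ≈ V + + P * s [mod p ℕ.* P ]
  open _≈_+P·_ public

  slope-cong : ∀ {v V s s′} → s ≈ s′ [mod p ] → v ≈ V +P· s → v ≈ V +P· s′
  slope-cong {V = V} s≈s′ (expansion v≈) =
    expansion (mod-trans v≈ (mod-+ (mod-refl {a = V})
                                   (mod-∣ (ND.∣-reflexive (ℕ.*-comm p P)) (mod-scale P s≈s′))))

  slope-≡ : ∀ {v V s s′} → s ≡ s′ → v ≈ V +P· s → v ≈ V +P· s′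
  slope-≡ refl v≈ = v≈

  constant : ∀ V → V ≈ V +P· + 0
  constant V = expansion (≡⇒mod (sym (trans (cong (_+_ V) (*-zeroʳ (+ P))) (+-identityʳ V))))

  +-expansion : ∀ {u U s v V t} → u ≈ U +P· s → v ≈ V +P· t → u + v ≈ U + V +P· (s + t)
  +-expansion {U = U} {s} {V = V} {t} (expansion u≈) (expansion v≈) =
    expansion (mod-trans (mod-+ u≈ v≈) (≡⇒mod (regroup U V (+ P) s t)))
    where regroup : ∀ a b q s t → a + q * s + (b + q * t) ≡ a + b + q * (s + t)
          regroup = solve-∀

  P²≈0 : + P * + P ≈ + 0 [mod p ℕ.* P ]
  P²≈0 = ∣⇒≈0 (subst (p ℕ.* P ND.∣_) (sym (abs-* (+ P) (+ P))) (ND.*-monoˡ-∣ P p∣P))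

  *-expansion : ∀ {u U s v V t} → u ≈ U +P· s → v ≈ V +P· t → u * v ≈ U * V +P· (s * V + U * t)
  *-expansion {u} {U} {s} {v} {V} {t} (expansion u≈) (expansion v≈) = expansion (begin
    u * v                                                 ≈⟨ mod-* u≈ v≈ ⟩
    (U + + P * s) * (V + + P * t)                         ≡⟨ expand U V s t (+ P) ⟩
    U * V + + P * (s * V + U * t) + + P * + P * (s * t)   ≈⟨ mod-+-≈0 (mod-*-≈0 (s * t) P²≈0) ⟩
    U * V + + P * (s * V + U * t)                         ∎)
    where
      open mod-Reasoning (p ℕ.* P)
      expand : ∀ U V s t P → (U + P * s) * (V + P * t) ≡ U * V + P * (s * V + U * t) + P * P * (s * t)
      expand = solve-∀

  scale-expansion : ∀ c {v V s} → v ≈ V +P· s → c * v ≈ c * V +P· c * s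
  scale-expansion c {V = V} {s} v≈ =
    slope-≡ (trans (cong (_+ c * s) (*-zeroˡ V)) (+-identityˡ (c * s))) (*-expansion (constant c) v≈)

  ΣF-expansion : ∀ n {v V s : Fin n → ℤ} → (∀ i → v i ≈ V i +P· s i) → ΣF n v ≈ ΣF n V +P· ΣF n s
  ΣF-expansion zero    _  = constant (+ 0)
  ΣF-expansion (suc n) v≈ = +-expansion (v≈ zero) (ΣF-expansion n (v≈ ∘ suc))

  -- Factors are expanded with logarithmic slopes Vℓ·gℓ, so the product rule sums the gℓ.
  ΠF-expansion : ∀ n {v V g : Fin n → ℤ} → (∀ i → v i ≈ V i +P· V i * g i) →
                 ΠF n v ≈ ΠF n V +P· ΠF n V * ΣF n g
  ΠF-expansion zero    _  = slope-≡ (sym (*-zeroʳ (+ 1))) (constant (+ 1))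
  ΠF-expansion (suc n) {V = V} {g} v≈ =
    slope-≡ (regroup (V zero) (g zero) (ΠF n (V ∘ suc)) (ΣF n (g ∘ suc)))
            (*-expansion (v≈ zero) (ΠF-expansion n (v≈ ∘ suc)))
    where regroup : ∀ a b c d → a * b * c + a * (c * d) ≡ a * c * (b + d)
          regroup = solve-∀

  pow-expansion : ∀ {x} i → x * i ≈ + 1 [mod p ] → ∀ z e →
                  (x + + P * z) ^ e ≈ x ^ e +P· x ^ e * (+ e * i * z)
  pow-expansion i x*i≈1 z zero = slope-≡ (vanish i z) (constant (+ 1))
    where vanish : ∀ i z → + 0 ≡ + 1 * (+ 0 * i * z)
          vanish = solve-∀
  pow-expansion {x} i x*i≈1 z (suc e) =
    slope-cong slope≈ (*-expansion {U = x} {s = z} (expansion mod-refl) (pow-expansion {x} i x*i≈1 z e))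
    where
      slope≈ : z * x ^ e + x * (x ^ e * (+ e * i * z)) ≈ x ^ suc e * (+ suc e * i * z) [mod p ]
      slope≈ = begin
        z * x ^ e + x * (x ^ e * (+ e * i * z))
          ≡⟨ cong (_+ x * (x ^ e * (+ e * i * z))) (*-identityˡ (z * x ^ e)) ⟨
        + 1 * (z * x ^ e) + x * (x ^ e * (+ e * i * z))
          ≈⟨ mod-+ (mod-* (mod-sym x*i≈1) mod-refl) mod-refl ⟩
        x * i * (z * x ^ e) + x * (x ^ e * (+ e * i * z))
          ≡⟨ regroup x i z (x ^ e) (+ e) ⟩
        x * x ^ e * ((+ 1 + + e) * i * z) ∎
        where
          open mod-Reasoning p
          regroup : ∀ x i z y e → x * i * (z * y) + x * (y * (e * i * z)) ≡ x * y * ((+ 1 + e) * i * z)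
          regroup = solve-∀

  eval-expansion : ∀ n t A E {X : Fin n → ℤ} → (∀ ℓ → X ℓ * invModP p (X ℓ) ≈ + 1 [mod p ]) → ∀ z →
                   eval n t A E (λ ℓ → X ℓ + + P * z ℓ) ≈ eval n t A E X +P· jacobian p n t A E X · z
  eval-expansion n t A E {X} inverses z =
    slope-≡ rearrange
      (ΣF-expansion t (λ j → scale-expansion (A j)
        (ΠF-expansion n (λ ℓ → pow-expansion (invModP p (X ℓ)) (inverses ℓ) (z ℓ) (E j ℓ)))))
    where
      Π : Fin t → ℤ
      Π j = ΠF n (λ ℓ → X ℓ ^ E j ℓ)
      g : Fin t → Fin n → ℤ
      g j ℓ = + E j ℓ * invModP p (X ℓ) * z ℓ
      rearrange : ΣF t (λ j → A j * (Π j * ΣF n (g j))) ≡ jacobian p n t A E X · z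
      rearrange = begin
        ΣF t (λ j → A j * (Π j * ΣF n (g j)))
          ≡⟨ ΣF-cong t (λ j → trans (cong (A j *_) (*-distribˡ-ΣF n (Π j) (g j)))
                                     (*-distribˡ-ΣF n (A j) _)) ⟩
        ΣF t (λ j → ΣF n (λ ℓ → A j * (Π j * g j ℓ)))
          ≡⟨ ΣF-comm t n _ ⟩
        ΣF n (λ ℓ → ΣF t (λ j → A j * (Π j * g j ℓ)))
          ≡⟨ ΣF-cong n (λ ℓ → trans (ΣF-cong t (λ j → regroup (A j) (Π j) (+ E j ℓ) (invModP p (X ℓ)) (z ℓ)))
                                     (sym (*-distribʳ-ΣF t (z ℓ) _))) ⟩
        jacobian p n t A E X · z ∎
        where
          open ≡-Reasoning
          regroup : ∀ a π e i z → a * (π * (e * i * z)) ≡ a * e * i * π * z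
          regroup = solve-∀

-- Hensel lifting

telescope : ∀ {M} (s : ℕ → ℤ) (d : ℕ → ℕ) → (∀ k → M ND.∣ d k) →
            (∀ k → s (suc k) ≈ s k [mod d k ]) → ∀ k → s k ≈ s 0 [mod M ]
telescope s d M∣d step zero    = mod-refl
telescope s d M∣d step (suc k) = mod-trans (mod-∣ (M∣d k) (step k)) (telescope s d M∣d step k)

compat≈ : ∀ {p} (b : ℤₚ p) k → seq b (suc k) ≈ seq b k [mod p ℕ.^ suc k ]
compat≈ b k = ≡-mod⇒≈-mod {a = seq b (suc k)} {b = seq b k} (compat b k)

ecompat≈ : ∀ {p} (e : 𝓔ₚ p) k → + eseq e (suc k) ≈ + eseq e k [mod φ (p ℕ.^ suc k) ]
ecompat≈ e k = ≡-mod⇒≈-mod {a = + eseq e (suc k)} {b = + eseq e k} (ecompat e k)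

module _ {p} (p-prime : Prime p) where

  seq≈seq₀ : (b : ℤₚ p) → ∀ k → seq b k ≈ seq b 0 [mod p ]
  seq≈seq₀ b = telescope (seq b) (λ k → p ℕ.^ suc k) (λ k → ND.m∣m*n (p ℕ.^ k)) (compat≈ b)

  eseq≈eseq₀ : (e : 𝓔ₚ p) → ∀ k → + eseq e k ≈ + eseq e 0 [mod p ∸ 1 ]
  eseq≈eseq₀ e = telescope (λ k → + eseq e k) (λ k → φ (p ℕ.^ suc k))
    (λ k → subst (p ∸ 1 ND.∣_) (sym (φ-prime-power p-prime k)) (ND.m∣m*n (p ℕ.^ k)))
    (ecompat≈ e)

  eseq≈eseq₁ : (e : 𝓔ₚ p) → ∀ k → + eseq e (suc k) ≈ + eseq e 1 [mod p ]
  eseq≈eseq₁ e = telescope (λ k → + eseq e (suc k)) (λ k → φ (p ℕ.^ suc (suc k)))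
    (λ k → subst (p ND.∣_) (sym (φ-prime-power p-prime (suc k)))
                 (ND.∣n⇒∣m*n (p ∸ 1) (ND.m∣m*n (p ℕ.^ k))))
    (ecompat≈ e ∘ suc)

  module _ (x : ℤ) (x-unit : ¬ (p ND.∣ ∣ x ∣)) (e : 𝓔ₚ p) where

    pow-eseq-suc : ∀ k → x ^ eseq e (suc k) ≈ x ^ eseq e k [mod p ℕ.^ suc k ]
    pow-eseq-suc k = pow-cong-exponent (euler-prime-power p-prime x x-unit k) (ecompat≈ e k)

    pow-eseq≈pow-eseq₀ : ∀ k → x ^ eseq e k ≈ x ^ eseq e 0 [mod p ]
    pow-eseq≈pow-eseq₀ k = pow-cong-exponent (fermat-unit p-prime x x-unit) (eseq≈eseq₀ e k)

module Hensel {p} (p-prime : Prime p) {m n} (t : Fin m → ℕ)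
    (a : (i : Fin m) → Fin (t i) → ℤₚ p) (α : (i : Fin m) → Fin (t i) → Fin n → 𝓔ₚ p)
    (y : Fin m → ℤₚ p) (x₁ : Fin n → ℤ) (x₁-unit : ∀ ℓ → ¬ (p ND.∣ ∣ x₁ ℓ ∣))
    (f[x₁]≡y : ∀ i → evalCoord n (t i) (a i) (α i) (λ ℓ → constℤₚ (x₁ ℓ)) 0 ≡ seq (y i) 0 [mod p ])
    (rank : HasRankMModP p m n (λ i ℓ → jacEntry n (t i) (a i) (α i) x₁ ℓ)) where

  A : ℕ → (i : Fin m) → Fin (t i) → ℤ
  A k i j = seq (a i j) k

  E : ℕ → (i : Fin m) → Fin (t i) → Fin n → ℕ
  E k i j ℓ = eseq (α i j ℓ) k

  F : ℕ → (Fin n → ℤ) → Fin m → ℤ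
  F k X i = eval n (t i) (A k i) (E k i) X

  J : Fin m → Fin n → ℤ
  J i ℓ = jacEntry n (t i) (a i) (α i) x₁ ℓ

  ≈x₁⇒unit : ∀ {X} ℓ → X ≈ x₁ ℓ [mod p ] → ¬ (p ND.∣ ∣ X ∣)
  ≈x₁⇒unit ℓ X≈x₁ p∣X = x₁-unit ℓ (≈0⇒∣ (mod-trans (mod-sym X≈x₁) (∣⇒≈0 p∣X)))

  F-suc : ∀ {X} → (∀ ℓ → ¬ (p ND.∣ ∣ X ℓ ∣)) → ∀ k i → F (suc k) X i ≈ F k X i [mod p ℕ.^ suc k ]
  F-suc {X} X-unit k i = ΣF-cong-mod (t i) (λ j → mod-* (compat≈ (a i j) k)
    (ΠF-cong-mod n (λ ℓ → pow-eseq-suc p-prime (X ℓ) (X-unit ℓ) (α i j ℓ) k)))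

  jacobian≈J : ∀ {X} → (∀ ℓ → X ℓ ≈ x₁ ℓ [mod p ]) → ∀ k i ℓ →
               jacobian p n (t i) (A (suc k) i) (E (suc k) i) X ℓ ≈ J i ℓ [mod p ]
  jacobian≈J {X} X≈x₁ k i ℓ = ΣF-cong-mod (t i) (λ j →
    mod-* (mod-* (mod-* (seq≈seq₀ p-prime (a i j) (suc k)) (eseq≈eseq₁ p-prime (α i j ℓ) k))
                 (mod-^ (p ∸ 2) (X≈x₁ ℓ)))
          (ΠF-cong-mod n (λ ℓ′ →
            mod-trans (pow-eseq≈pow-eseq₀ p-prime (X ℓ′) (≈x₁⇒unit ℓ′ (X≈x₁ ℓ′)) (α i j ℓ′) (suc k))
                      (mod-^ (E 0 i j ℓ′) (X≈x₁ ℓ′)))))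

  record Approximation (k : ℕ) : Set where
    field
      point  : Fin n → ℤ
      ≈x₁    : ∀ ℓ → point ℓ ≈ x₁ ℓ [mod p ]
      solves : ∀ i → F k point i ≈ seq (y i) k [mod p ℕ.^ suc k ]
  open Approximation public

  initial : Approximation 0
  initial = record
    { point  = x₁
    ; ≈x₁    = λ _ → mod-refl
    ; solves = λ i → mod-∣ (ND.∣-reflexive (ℕ.*-identityʳ p)) (≡-mod⇒≈-mod (f[x₁]≡y i))
    }

  module Step {k} (X : Approximation k) where

    P : ℕ
    P = p ℕ.^ suc k

    X-unit : ∀ ℓ → ¬ (p ND.∣ ∣ point X ℓ ∣)
    X-unit ℓ = ≈x₁⇒unit ℓ (≈x₁ X ℓ)

    F-suc≈y : ∀ i → F (suc k) (point X) i ≈ seq (y i) (suc k) [mod P ]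
    F-suc≈y i = mod-trans (F-suc X-unit k i) (mod-trans (solves X i) (mod-sym (compat≈ (y i) k)))

    residue : Fin m → ℤ
    residue i = quotient (F-suc≈y i)

    linearSolution : Solution p J (λ i → - residue i)
    linearSolution = solve-fullRank p-prime m J rank (λ i → - residue i)

    correction : Fin n → ℤ
    correction = proj₁ linearSolution

    corrected : Fin n → ℤ
    corrected ℓ = point X ℓ + + P * correction ℓ

    corrected≈point : ∀ ℓ → corrected ℓ ≈ point X ℓ [mod P ]
    corrected≈point ℓ = congruence (correction ℓ) (cong (_+_ (point X ℓ)) (*-comm (+ P) (correction ℓ)))

    corrected≈x₁ : ∀ ℓ → corrected ℓ ≈ x₁ ℓ [mod p ]
    corrected≈x₁ ℓ = mod-trans (mod-∣ (ND.m∣m*n (p ℕ.^ k)) (corrected≈point ℓ)) (≈x₁ X ℓ)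

    inverses : ∀ ℓ → point X ℓ * invModP p (point X ℓ) ≈ + 1 [mod p ]
    inverses ℓ = *-invModP≈1 p-prime (point X ℓ) (X-unit ℓ)

    open FirstOrder p P (ND.m∣m*n (p ℕ.^ k)) using (congruent; eval-expansion)

    corrected-solves : ∀ i → F (suc k) corrected i ≈ seq (y i) (suc k) [mod p ℕ.* P ]
    corrected-solves i = begin
      F (suc k) corrected i
        ≈⟨ congruent (eval-expansion n (t i) (A (suc k) i) (E (suc k) i) inverses correction) ⟩
      F (suc k) (point X) i + + P * (∂ · correction)
        ≡⟨ cong (_+ + P * (∂ · correction)) (equation (F-suc≈y i)) ⟩
      seq (y i) (suc k) + residue i * + P + + P * (∂ · correction)
        ≡⟨ regroup (seq (y i) (suc k)) (residue i) (+ P) (∂ · correction) ⟩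
      seq (y i) (suc k) + + P * (residue i + ∂ · correction)
        ≈⟨ mod-+ (mod-refl {a = seq (y i) (suc k)})
                 (mod-∣ (ND.∣-reflexive (ℕ.*-comm p P)) (mod-scale P r+∂z≈0)) ⟩
      seq (y i) (suc k) + + P * + 0
        ≡⟨ trans (cong (_+_ (seq (y i) (suc k))) (*-zeroʳ (+ P))) (+-identityʳ _) ⟩
      seq (y i) (suc k) ∎
      where
        open mod-Reasoning (p ℕ.* P)
        ∂ : Fin n → ℤ
        ∂ = jacobian p n (t i) (A (suc k) i) (E (suc k) i) (point X)
        ∂z≈Jz : ∂ · correction ≈ J i · correction [mod p ]
        ∂z≈Jz = ΣF-cong-mod n (λ ℓ → mod-* (jacobian≈J (≈x₁ X) k i ℓ) mod-refl)
        r+∂z≈0 : residue i + ∂ · correction ≈ + 0 [mod p ]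
        r+∂z≈0 = mod-trans (mod-+ (mod-refl {a = residue i}) (mod-trans ∂z≈Jz (proj₂ linearSolution i)))
                           (≡⇒mod (+-inverseʳ (residue i)))
        regroup : ∀ y r P s → y + r * P + P * s ≡ y + P * (r + s)
        regroup = solve-∀

    next : Approximation (suc k)
    next = record { point = corrected ; ≈x₁ = corrected≈x₁ ; solves = corrected-solves }

  approximation : ∀ k → Approximation k
  approximation zero    = initial
  approximation (suc k) = Step.next (approximation k)

  solution : Fin n → ℤₚ p
  solution ℓ = record
    { seq    = λ k → point (approximation k) ℓ
    ; compat = λ k → ≈-mod⇒≡-mod (Step.corrected≈point (approximation k) ℓ)
    }

proposition2p11 :
  (p : ℕ) → Prime p → ¬ (2 ND.∣ p) →
  (m n : ℕ) → 1 ≤ m → m ≤ n →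
  (t : Fin m → ℕ) →
  (a : (i : Fin m) → Fin (t i) → ℤₚ p) →
  (α : (i : Fin m) → Fin (t i) → Fin n → 𝓔ₚ p) →
  (y : Fin m → ℤₚ p) →
  (x₁ : Fin n → ℤ) → (∀ ℓ → ¬ ((+ p) ∣ x₁ ℓ)) →
  (∀ i → evalCoord n (t i) (a i) (α i) (λ ℓ → constℤₚ (x₁ ℓ)) 0 ≡ seq (y i) 0 [mod p ]) →
  HasRankMModP p m n (λ i ℓ → jacEntry n (t i) (a i) (α i) x₁ ℓ) →
  Σ (Fin n → ℤₚ p) (λ x →
    (∀ ℓ → IsUnit (x ℓ)) × (∀ ℓ → seq (x ℓ) 0 ≡ x₁ ℓ) ×
    (∀ i k → evalCoord n (t i) (a i) (α i) x k ≡ seq (y i) k [mod p Data.Nat.^ Data.Nat.suc k ]))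
proposition2p11 p p-prime _ m n _ _ t a α y x₁ x₁-unit f[x₁]≡y rank =
  solution , x₁-unit , (λ _ → refl) , λ i k → ≈-mod⇒≡-mod (solves (approximation k) i)
  where open Hensel p-prime t a α y x₁ x₁-unit f[x₁]≡y rank
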